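{- Let $CC$ be a C-system, $n\ge0$, $m\ge1$, $Y$ an object of length $n$, $X$ an object of length $m$, and $s_1,\dots,s_m\in\widetilde B_{n+1}$ (in $uB(CC)$). Say that a tuple $(Y,X,s_1,\dots,s_m)$ corresponds to a morphism if there is a morphism $f:Y\to X$ with $s_i(f)=s_i$ for $i=1,\dots,m$. Then $(Y,X,s_1,\dots,s_m)$ corresponds to a morphism if and only if $(Y,ft(X),s_1,\dots,s_{m-1})$ corresponds to a morphism and $\partial(s_m)=Z_{m,m-1}$, where the elements $Z_{m,i}$ are defined inductively by $Z_{m,0}=T_n(Y,X)$ and $Z_{m,i+1}=S(s_{i+1},Z_{m,i})$ (the operations being those of $uB(CC)$).
   Context: C-systems: a C0-system is a category $CC$ with a function $l:Ob(CC)\to\mathbb{N}$, an object $pt$, a function $ft:Ob\to Ob$, morphisms $p_X:X\to ft(X)$, and for $l(X)>0$, $f:Y\to ft(X)$ an object $f^*X$ and morphism $q(f,X):f^*X\to X$, such that: $pt$ is the only object of length $0$; $l(ftX)=l(X)-1$ for $l(X)>0$, $ft(pt)=pt$; $pt$ is final; $l(f^*X)>0$, $ft(f^*X)=Y$, $p_X\circ q(f,X)=f\circ p_{f^*X}$ and this square is a pullback; $(id_{ftX})^*X=X$, $q(id,X)=id_X$; $(f\circ g)^*X=g^*(f^*X)$, $q(f\circ g,X)=q(f,X)\circ q(g,f^*X)$. A C-system is a C0-system with, for every $f:Y\to X$ with $l(X)>0$, a morphism $s_f:Y\to(ft(f))^*X$, $ft(f):=p_X\circ f$, with $p_{(ftf)^*X}\circ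 s_f=id_Y$, $q(ftf,X)\circ s_f=f$, and $s_f=s_{q(g,U)\circ f}$ whenever $X=g^*U$ with $g:ft(X)\to ft(U)$. $uB(CC)$: $B_n=\{X\mid l(X)=n\}$; $\widetilde B_{n+1}=\{(V,t)\mid l(V)=n+1,\ t:ft(V)\to V,\ p_V\circ t=id\}$; $\partial(V,t)=V$. For $f:Y\to ft^i(X)$: $f^*(X,0)=Y$, $q(f,X,0)=f$, $f^*(X,i+1)=q(f,ftX,i)^*X$, $q(f,X,i+1)=q(q(f,ftX,i),X)$. For $m'\ge n'\ge0$, $Y'\in B_{n'+1}$, $X'\in B_{m'+1}$ with $ft(Y')=ft^{m'+1-n'}(X')$: $T(Y',X')=p_{Y'}^*(X',m'+1-n')$. For $(V,t)\in\widetilde B_{n'+1}$, $X'\in B_{m'+2}$ with $V=ft^{m'+1-n'}(X')$: $S((V,t),X')=t^*(X',m'+1-n')$. Iterated weakening: for $m'\ge n'\ge0$, $j\ge0$, $Y'\in B_{n'+j}$, $X'\in B_{m'+1}$ with $ft^j(Y')=ft^{m'+1-n'}(X')$, $T_0(Y',X')=X'$ and $T_j(Y',X')=T(Y',T_{j-1}(ft(Y'),X'))$; in particular $T_n(Y,X)$ is taken with $n'=0$, $m'=m-1$. For a morphism $f:Y\to X$ with $l(Y)=n$, $l(X)=m$, the sequence $(s_1(f),\dots,s_m(f))$ of elements of $\widetilde B_{n+1}$ is defined by: the empty sequence if $m=0$, and for $m\ge1$, $(s_1(f),\dots,s_m(f))=(s_1(ft(f)),\dots,s_{m-1}(ft(f)),((ft(f))^*X,s_f))$,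 where $ft(f)=p_X\circ f:Y\to ft(X)$ and $s_f$ is regarded as a section of $p_{(ft f)^*X}$. -}

module Defs where

open import Level using (Level; _⊔_; Lift) renaming (suc to lsuc)
open import Data.Nat using (ℕ; zero; suc; _∸_; _<_; _≤_)
open import Data.Nat.Properties using (≤-refl)
open import Data.Product using (Σ; _×_; _,_; proj₁; proj₂)
open import Data.Vec using (Vec; []; _∷_; _∷ʳ_; init; last)
open import Data.Vec using (toList)
open import Data.List using (List; []; _∷_)
open import Relation.Binary.PropositionalEquality
  using (_≡_; refl; sym; trans; cong; subst)
open import Relation.Binary.HeterogeneousEquality using (_≅_)

-- Ob and Hom are types whose equality is _≡_; since Agda is used with K
-- (the default), these are sets, as in the paper.
-- The operations f^*X, q(f,X), s_f are given as total operations; all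
-- axioms about them are imposed exactly for l(X) > 0, where the paper
-- defines them (values for l(X) = 0 are unconstrained junk and never used).

record CSystem (o h : Level) : Set (lsuc (o ⊔ h)) where
  infixr 9 _∘_
  field
    Ob    : Set o
    Hom   : Ob → Ob → Set h
    id    : ∀ {A} → Hom A A
    _∘_   : ∀ {A B D} → Hom B D → Hom A B → Hom A D
    idˡ   : ∀ {A B} (f : Hom A B) → id ∘ f ≡ f
    idʳ   : ∀ {A B} (f : Hom A B) → f ∘ id ≡ f
    assoc : ∀ {A B D E} (h : Hom D E) (g : Hom B D) (f : Hom A B) →
            (h ∘ g) ∘ f ≡ h ∘ (g ∘ f)
    l     : Ob → ℕ
    pt    : Ob
    ft    : Ob → Ob
    p     : (X : Ob) → Hom X (ft X)
    pb    : ∀ {Y} (X : Ob) → Hom Y (ft X) → Ob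
    q     : ∀ {Y} (X : Ob) (f : Hom Y (ft X)) → Hom (pb X f) X
    l-pt      : l pt ≡ 0
    pt-unique : ∀ X → l X ≡ 0 → X ≡ pt
    l-ft      : ∀ X → 0 < l X → l (ft X) ≡ l X ∸ 1
    ft-pt     : ft pt ≡ pt
    pt-final  : ∀ A → Σ (Hom A pt) (λ u → ∀ (g : Hom A pt) → g ≡ u)
    l-pb      : ∀ X → 0 < l X → ∀ {Y} (f : Hom Y (ft X)) → 0 < l (pb X f)
    ft-pb     : ∀ X → 0 < l X → ∀ {Y} (f : Hom Y (ft X)) → ft (pb X f) ≡ Y
    pb-square : ∀ X (lX : 0 < l X) {Y} (f : Hom Y (ft X)) →
                p X ∘ q X f ≡ f ∘ subst (Hom (pb X f)) (ft-pb X lX f) (p (pb X f))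
    pb-universal :
      ∀ X (lX : 0 < l X) {Y} (f : Hom Y (ft X)) {W}
        (a : Hom W Y) (b : Hom W X) → p X ∘ b ≡ f ∘ a →
        Σ (Hom W (pb X f)) λ u →
          ((subst (Hom (pb X f)) (ft-pb X lX f) (p (pb X f)) ∘ u ≡ a) × (q X f ∘ u ≡ b))
          × (∀ (u' : Hom W (pb X f)) →
               subst (Hom (pb X f)) (ft-pb X lX f) (p (pb X f)) ∘ u' ≡ a →
               q X f ∘ u' ≡ b → u' ≡ u)
    pb-id     : ∀ X → 0 < l X → pb X (id {ft X}) ≡ X
    q-id      : ∀ X → 0 < l X → q X (id {ft X}) ≅ id {X}
    pb-comp   : ∀ X (lX : 0 < l X) {Y Y'} (f : Hom Y (ft X)) (g : Hom Y' Y) →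
                pb X (f ∘ g) ≡ pb (pb X f) (subst (Hom Y') (sym (ft-pb X lX f)) g)
    q-comp    : ∀ X (lX : 0 < l X) {Y Y'} (f : Hom Y (ft X)) (g : Hom Y' Y) →
                q X (f ∘ g) ≅ q X f ∘ q (pb X f) (subst (Hom Y') (sym (ft-pb X lX f)) g)
    -- C-system data: s_f : Y → (ft f)^*X for f : Y → X, ft f = p_X ∘ f
    s     : ∀ {Y} (X : Ob) (f : Hom Y X) → Hom Y (pb X (p X ∘ f))
    s-sec : ∀ X (lX : 0 < l X) {Y} (f : Hom Y X) →
            subst (Hom (pb X (p X ∘ f))) (ft-pb X lX (p X ∘ f)) (p (pb X (p X ∘ f)))
              ∘ s X f ≡ id
    s-q   : ∀ X → 0 < l X → ∀ {Y} (f : Hom Y X) → q X (p X ∘ f) ∘ s X f ≡ f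
    s-nat : ∀ U → 0 < l U → ∀ {W} (g : Hom W (ft U)) {Y} (f : Hom Y (pb U g)) →
            s (pb U g) f ≅ s U (q U g ∘ f)

module _ {o h : Level} (C : CSystem o h) where
  open CSystem C

  ftⁿ : ℕ → Ob → Ob
  ftⁿ zero    X = X
  ftⁿ (suc i) X = ftⁿ i (ft X)

  pbIter : (i : ℕ) {Y : Ob} (X : Ob) → Hom Y (ftⁿ i X) → Σ Ob (λ Z → Hom Z X)
  pbIter zero    {Y} X f = Y , f
  pbIter (suc i) {Y} X f =
    pb X (proj₂ (pbIter i (ft X) f)) , q X (proj₂ (pbIter i (ft X) f))

  record Bt : Set (o ⊔ h) where
    constructor mkBt
    field
      V : Ob
      t : Hom (ft V) V
  open Bt public

  InBt : ℕ → Bt → Set h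
  InBt n b = (l (V b) ≡ suc n) × (p (V b) ∘ t b ≡ id)

  ∂ : Bt → Ob
  ∂ = V

  -- T(Y',X') is defined and equals W.
  -- (Y' ∈ B_{n'+1}, X' ∈ B_{m'+1}, m' ≥ n' ≥ 0, ft Y' = ft^{m'+1-n'} X';
  --  note m'+1-n' = suc (l X' ∸ l Y'))
  TRel : Ob → Ob → Ob → Set o
  TRel Y' X' W =
    (1 ≤ l Y') × (l Y' ≤ l X') ×
    Σ (ft Y' ≡ ftⁿ (suc (l X' ∸ l Y')) X') λ e →
      W ≡ proj₁ (pbIter (suc (l X' ∸ l Y')) X' (subst (Hom Y') e (p Y')))

  -- S((V,t),X') is defined and equals W.
  -- ((V,t) ∈ B̃_{n'+1}, X' ∈ B_{m'+2}, m' ≥ n' ≥ 0, V = ft^{m'+1-n'} X';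
  --  note m'+1-n' = l X' ∸ l V)
  SRel : Bt → Ob → Ob → Set (o ⊔ h)
  SRel b X' W =
    (1 ≤ l (V b)) × (suc (l (V b)) ≤ l X') × (p (V b) ∘ t b ≡ id) ×
    Σ (V b ≡ ftⁿ (l X' ∸ l (V b)) X') λ e →
      W ≡ proj₁ (pbIter (l X' ∸ l (V b)) X' (subst (Hom (ft (V b))) e (t b)))

  TjRel : ℕ → Ob → Ob → Ob → Set o
  TjRel zero    Y' X' W = W ≡ X'
  TjRel (suc j) Y' X' W = Σ Ob λ W' → TjRel j (ft Y') X' W' × TRel Y' W' W

  -- Z_{m,0} = W0 and Z_{m,i+1} = S(s_{i+1}, Z_{m,i}): given W0 and the list
  -- (s_1,...,s_k), ZFold W0 (s_1,...,s_k) W says Z_{m,k} is defined and = W.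
  ZFold : Ob → List Bt → Ob → Set (o ⊔ h)
  ZFold W0 []       W = Lift h (W ≡ W0)
  ZFold W0 (b ∷ bs) W = Σ Ob λ W1 → SRel b W0 W1 × ZFold W1 bs W

  -- s_f viewed as a section of p_{(ft f)^*X} : (ft f)^*X → ft((ft f)^*X) = Y
  sBt : ∀ {Y} (X : Ob) → 0 < l X → Hom Y X → Bt
  sBt {Y} X lX f =
    mkBt (pb X (p X ∘ f))
         (subst (λ A → Hom A (pb X (p X ∘ f))) (sym (ft-pb X lX (p X ∘ f))) (s X f))

  private
    pos : ∀ {X m} → l X ≡ suc m → 0 < l X
    pos e = subst (0 <_) (sym e) (Data.Nat.s≤s Data.Nat.z≤n)

    lft : ∀ {X m} → l X ≡ suc m → l (ft X) ≡ m
    lft {X} e = trans (l-ft X (pos e)) (cong (_∸ 1) e)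

  sSeq : (m : ℕ) {Y X : Ob} → l X ≡ m → Hom Y X → Vec Bt m
  sSeq zero    e f = []
  sSeq (suc m) {Y} {X} e f = sSeq m (lft e) (p X ∘ f) ∷ʳ sBt X (pos e) f

  Corresponds : (m : ℕ) → Ob → Ob → Vec Bt m → Set (o ⊔ h)
  Corresponds m Y X ss =
    Σ (l X ≡ m) λ e → Σ (Hom Y X) λ f → sSeq m e f ≡ ss

module Submission where

-- Write g^*(X,k) for the iterated pullback (pbIter).  Everything rests on
-- identifying the operations T and S of uB(CC) with iterated pullbacks:
--   * weakening is pullback along the map to pt: for X of length k+1 and the
--     unique g : Y → ft^{k+1} X = pt, T_n(Y,X) = g^*(X,k+1);
--   * for g : Y → ft^{k+1} X,  S(s_g, (ft g)^*(X,k+2)) = g^*(X,k+1),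
--     because g = q(ft g) ∘ s_g and iterated pullback is functorial.
-- By induction on the length, the fold Z_{m,i} over s₁(g), …, s_m(g) starting
-- from T_n(Y,X) ends at g^*X, for every g : Y → ft X.  Since T and S are
-- partial functions, the Z_{m,i} are uniquely determined.  Finally a section
-- t of p over g^*X lifts to f = q(g,X) ∘ t with ft f = g and s_{m+1}(f) = t,
-- by the universal property of the pullback.  The theorem follows: forwards
-- with g = ft f, backwards with the morphism g witnessing the first m terms.

open import Defs
open import Level using (Level; _⊔_; lift)
open import Data.Nat using (ℕ; suc; zero; _+_; _∸_; _≤_; _<_; s≤s; z≤n)
open import Data.Nat.Properties using (≤-irrelevant; +-suc; +-identityʳ; m≤n+m; m+n∸n≡m)
open import Data.Product using (Σ; _×_; _,_; proj₁; proj₂)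
open import Data.Vec using (Vec; lookup; init; last; toList; []; _∷_; _∷ʳ_; initLast)
open import Data.Vec.Properties using (init-∷ʳ; last-∷ʳ)
open import Data.Fin using (Fin; fromℕ)
open import Data.List using ([]; _∷_)
open import Function.Bundles using (_⇔_; mk⇔)
open import Relation.Binary.PropositionalEquality using (_≡_; refl; sym; trans; cong; cong₂; subst; subst₂; module ≡-Reasoning)
open import Relation.Binary.HeterogeneousEquality as H using (_≅_; ≅-to-≡; ≡-to-≅) renaming (≡-subst-removable to subst≅)

-- Equality proofs are unique (Agda's default K): the witnesses stored in
-- TRel, SRel and Corresponds carry no information.
uip : ∀ {a} {A : Set a} {x y : A} (e e' : x ≡ y) → e ≡ e'
uip refl refl = refl

lookup-last : ∀ {a} {A : Set a} {m} (xs : Vec A (suc m)) → lookup xs (fromℕ m) ≡ last xs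
lookup-last (x ∷ [])     = refl
lookup-last (x ∷ y ∷ ys) = lookup-last (y ∷ ys)

module Development {o h : Level} (C : CSystem o h) where
  open CSystem C

  ft^ : ℕ → Ob → Ob
  ft^ = ftⁿ C

  pb^ : (k : ℕ) {Y : Ob} (X : Ob) → Hom Y (ft^ k X) → Ob
  pb^ k X f = proj₁ (pbIter C k X f)

  q^ : (k : ℕ) {Y : Ob} (X : Ob) (f : Hom Y (ft^ k X)) → Hom (pb^ k X f) X
  q^ k X f = proj₂ (pbIter C k X f)

  ∘-cong≅ : ∀ {A A' B B' D D'} {f : Hom B D} {f' : Hom B' D'} {g : Hom A B} {g' : Hom A' B'} →
            A ≡ A' → B ≡ B' → D ≡ D' → f ≅ f' → g ≅ g' → (f ∘ g) ≅ (f' ∘ g')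
  ∘-cong≅ refl refl refl H.refl H.refl = H.refl

  id-cong≅ : ∀ {A A'} → A ≡ A' → id {A} ≅ id {A'}
  id-cong≅ refl = H.refl

  p-cong≅ : ∀ {A A'} → A ≡ A' → p A ≅ p A'
  p-cong≅ refl = H.refl

  pb-cong : ∀ {X X' Y Y'} {f : Hom Y (ft X)} {f' : Hom Y' (ft X')} →
            X ≡ X' → Y ≡ Y' → f ≅ f' → pb X f ≡ pb X' f'
  pb-cong refl refl H.refl = refl

  q-cong≅ : ∀ {X X' Y Y'} {f : Hom Y (ft X)} {f' : Hom Y' (ft X')} →
            X ≡ X' → Y ≡ Y' → f ≅ f' → q X f ≅ q X' f'
  q-cong≅ refl refl H.refl = H.refl

  pb^-cong : ∀ k {X X' Y Y'} {f : Hom Y (ft^ k X)} {f' : Hom Y' (ft^ k X')} →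
             X ≡ X' → Y ≡ Y' → f ≅ f' → pb^ k X f ≡ pb^ k X' f'
  pb^-cong k refl refl H.refl = refl

  q^-cong≅ : ∀ k {X X' Y Y'} {f : Hom Y (ft^ k X)} {f' : Hom Y' (ft^ k X')} →
             X ≡ X' → Y ≡ Y' → f ≅ f' → q^ k X f ≅ q^ k X' f'
  q^-cong≅ k refl refl H.refl = H.refl

  pos : ∀ {X m} → l X ≡ suc m → 0 < l X
  pos e = subst (0 <_) (sym e) (s≤s z≤n)

  l-ft≡ : ∀ {X m} → l X ≡ suc m → l (ft X) ≡ m
  l-ft≡ {X} e = trans (l-ft X (pos e)) (cong (_∸ 1) e)

  l-suc-ft : ∀ Z → 0 < l Z → l Z ≡ suc (l (ft Z))
  l-suc-ft Z lZ with l Z | lZ | l-ft Z lZ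
  ... | suc a | _ | e = cong suc (sym e)

  ft^-suc : ∀ k X → ft^ (suc k) X ≡ ft (ft^ k X)
  ft^-suc zero    X = refl
  ft^-suc (suc k) X = ft^-suc k (ft X)

  l-ft^ : ∀ k j X → l X ≡ k + j → l (ft^ k X) ≡ j
  l-ft^ zero    j X e = e
  l-ft^ (suc k) j X e = l-ft^ k j (ft X) (l-ft≡ e)

  l-pb^ : ∀ k j X {Y} (f : Hom Y (ft^ k X)) → l X ≡ k + j → l (pb^ k X f) ≡ k + l Y
  l-pb^ zero    j X f e = refl
  l-pb^ (suc k) j X f e =
    trans (l-suc-ft (pb X qf) (l-pb X (pos e) qf))
          (cong suc (trans (cong l (ft-pb X (pos e) qf)) (l-pb^ k j (ft X) f (l-ft≡ e))))
    where qf = q^ k (ft X) f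

  ft^-pb^ : ∀ k j X {Y} (f : Hom Y (ft^ k X)) → l X ≡ k + j → ft^ k (pb^ k X f) ≡ Y
  ft^-pb^ zero    j X f e = refl
  ft^-pb^ (suc k) j X f e =
    trans (cong (ft^ k) (ft-pb X (pos e) (q^ k (ft X) f))) (ft^-pb^ k j (ft X) f (l-ft≡ e))

  -- Iterated pullback is functorial:  (a ∘ b)^*(X,k) = b^*(a^*(X,k),k)  and
  -- q(a∘b,X,k) = q(a,X,k) ∘ q(b,a^*(X,k),k).  (b' is b retyped along
  -- ft^k(a^*(X,k)) = B.)
  pb^-comp : ∀ k j X → l X ≡ k + j → ∀ {B Y} (a : Hom B (ft^ k X)) (b : Hom Y B)
             (b' : Hom Y (ft^ k (pb^ k X a))) → b ≅ b' →
             (pb^ k X (a ∘ b) ≡ pb^ k (pb^ k X a) b') × (q^ k X (a ∘ b) ≅ q^ k X a ∘ q^ k (pb^ k X a) b')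
  pb^-comp zero j X e a b b' bb' with ≅-to-≡ bb'
  ... | refl = refl , H.refl
  pb^-comp (suc k) j X e {Y = Y} a b b' bb' =
      trans (pb-cong refl eP eQ) (trans (pb-comp X lX qa qb) pb-eq)
    , H.trans (q-cong≅ refl eP eQ) (H.trans (q-comp X lX qa qb) (∘-cong≅ pb-eq refl refl H.refl (q-cong≅ refl eP' qb'≅)))
    where
    lX = pos e
    qa = q^ k (ft X) a
    ft-eq = ft-pb X lX qa
    b'' = subst (λ Z → Hom Y (ft^ k Z)) ft-eq b'
    b''≅b' : b'' ≅ b'
    b''≅b' = subst≅ (λ Z → Hom Y (ft^ k Z)) ft-eq b'
    ih = pb^-comp k j (ft X) (l-ft≡ e) a b b'' (H.trans bb' (H.sym b''≅b'))
    eP = proj₁ ih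
    eQ = proj₂ ih
    eP' : pb^ k (pb^ k (ft X) a) b'' ≡ pb^ k (ft (pb X qa)) b'
    eP' = pb^-cong k (sym ft-eq) refl b''≅b'
    qb = q^ k (pb^ k (ft X) a) b''
    -- qb retyped into ft (pb X qa), as pb-comp requires
    qb'≅ : subst (Hom (pb^ k (pb^ k (ft X) a) b'')) (sym ft-eq) qb ≅ q^ k (ft (pb X qa)) b'
    qb'≅ = H.trans (subst≅ (Hom _) (sym ft-eq) qb) (q^-cong≅ k (sym ft-eq) refl b''≅b')
    pb-eq : pb (pb X qa) (subst (Hom (pb^ k (pb^ k (ft X) a) b'')) (sym ft-eq) qb) ≡ pb (pb X qa) (q^ k (ft (pb X qa)) b')
    pb-eq = pb-cong refl eP' qb'≅

  pb^-shift : ∀ k j X → l X ≡ suc k + j → ∀ {Y} (g : Hom Y (ft^ (suc k) X)) (g' : Hom Y (ft (ft^ k X))) → g ≅ g' →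
              (pb^ (suc k) X g ≡ pb^ k X (q (ft^ k X) g')) × (q^ (suc k) X g ≅ q^ k X (q (ft^ k X) g'))
  pb^-shift zero j X e g g' gg' with ≅-to-≡ gg'
  ... | refl = refl , H.refl
  pb^-shift (suc k) j X e g g' gg' =
    pb-cong refl (proj₁ ih) (proj₂ ih) , q-cong≅ refl (proj₁ ih) (proj₂ ih)
    where ih = pb^-shift k j (ft X) (l-ft≡ e) g g' gg'

  pb^-id : ∀ k j X → l X ≡ k + j → (pb^ k X (id {ft^ k X}) ≡ X) × (q^ k X (id {ft^ k X}) ≅ id {X})
  pb^-id zero    j X e = refl , H.refl
  pb^-id (suc k) j X e =
      trans (pb-cong refl (proj₁ ih) (proj₂ ih)) (pb-id X (pos e))
    , H.trans (q-cong≅ refl (proj₁ ih) (proj₂ ih)) (q-id X (pos e))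
    where ih = pb^-id k j (ft X) (l-ft≡ e)

  to-pt-unique : ∀ {A B} → B ≡ pt → (u v : Hom A B) → u ≡ v
  to-pt-unique {A} refl u v = trans (proj₂ (pt-final A) u) (sym (proj₂ (pt-final A) v))

  to-pt : ∀ A {B} → B ≡ pt → Hom A B
  to-pt A e = subst (Hom A) (sym e) (proj₁ (pt-final A))

  to-pt-≅-id : ∀ {Y B} → Y ≡ pt → B ≡ pt → (g : Hom Y B) → g ≅ id {B}
  to-pt-≅-id refl refl g = ≡-to-≅ (to-pt-unique refl g id)

  ft^-pt : ∀ k X → l X ≡ k → ft^ k X ≡ pt
  ft^-pt k X e = pt-unique _ (l-ft^ k 0 X (trans e (sym (+-identityʳ k))))

  T-functional : ∀ {Y W' Z Z'} → TRel C Y W' Z → TRel C Y W' Z' → Z ≡ Z'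
  T-functional (_ , _ , e , z) (_ , _ , e' , z') with uip e e'
  ... | refl = trans z (sym z')

  Tj-functional : ∀ j {Y X Z Z'} → TjRel C j Y X Z → TjRel C j Y X Z' → Z ≡ Z'
  Tj-functional zero    refl refl = refl
  Tj-functional (suc j) (W , tj , tr) (W' , tj' , tr') with Tj-functional j tj tj'
  ... | refl = T-functional tr tr'

  S-functional : ∀ {b W0 W W'} → SRel C b W0 W → SRel C b W0 W' → W ≡ W'
  S-functional (_ , _ , _ , e , z) (_ , _ , _ , e' , z') with uip e e'
  ... | refl = trans z (sym z')

  ZFold-functional : ∀ {Z₀} bs {W W'} → ZFold C Z₀ bs W → ZFold C Z₀ bs W' → W ≡ W'
  ZFold-functional []       (lift z) (lift z') = trans z (sym z')
  ZFold-functional (b ∷ bs) (W , s , z) (W' , s' , z') with S-functional s s'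
  ... | refl = ZFold-functional bs z z'

  ZFold-snoc : ∀ {r Z₀ W' W} (bs : Vec (Bt C) r) b → ZFold C Z₀ (toList bs) W' → SRel C b W' W →
               ZFold C Z₀ (toList (bs ∷ʳ b)) W
  ZFold-snoc {W = W} []       b (lift refl)  s = W , s , lift refl
  ZFold-snoc         (c ∷ bs) b (W , s₁ , z) s = W , s₁ , ZFold-snoc bs b z s

  -- Weakening is pullback along the map to pt.  Here l X = K = k+1, so
  -- ft^K X = pt and every g : Y → ft^K X is the unique such map.
  module Weakening (X : Ob) (k : ℕ) (lX : l X ≡ suc k) where
    K : ℕ
    K = suc k

    lX+0 : l X ≡ K + 0
    lX+0 = trans lX (cong suc (sym (+-identityʳ k)))

    base-pt : ft^ K X ≡ pt
    base-pt = ft^-pt K X lX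

    -- One weakening step: for l Y = n+1 and g₀ : ft Y → pt,
    -- T(Y, g₀^*(X,K)) = g^*(X,K), because g = g₀ ∘ p_Y.
    T-pb^ : ∀ {Y} n → l Y ≡ suc n → (g₀ : Hom (ft Y) (ft^ K X)) (g : Hom Y (ft^ K X)) →
            TRel C Y (pb^ K X g₀) (pb^ K X g)
    T-pb^ {Y} n lY g₀ g = pos lY , l-le , pullback-eq (l W' ∸ l Y) gap
      where
      W' = pb^ K X g₀
      lW : l W' ≡ K + n
      lW = trans (l-pb^ K 0 X g₀ lX+0) (cong (K +_) (l-ft≡ lY))
      l-le : l Y ≤ l W'
      l-le = subst₂ _≤_ (sym lY) (sym lW) (s≤s (m≤n+m n k))
      gap : l W' ∸ l Y ≡ k
      gap = trans (cong₂ _∸_ lW lY) (m+n∸n≡m k n)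
      pullback-eq : ∀ j → j ≡ k → Σ (ft Y ≡ ft^ (suc j) W') λ e →
                    pb^ K X g ≡ pb^ (suc j) W' (subst (Hom Y) e (p Y))
      pullback-eq .k refl =
        e , trans (cong (pb^ K X) (to-pt-unique base-pt g (g₀ ∘ p Y)))
                  (proj₁ (pb^-comp K 0 X lX+0 g₀ (p Y) (subst (Hom Y) e (p Y)) (H.sym (subst≅ (Hom Y) e (p Y)))))
        where
        e : ft Y ≡ ft^ K W'
        e = sym (ft^-pb^ K 0 X g₀ lX+0)

    Tj-pb^ : ∀ n {Y} → l Y ≡ n → (g : Hom Y (ft^ K X)) → TjRel C n Y X (pb^ K X g)
    Tj-pb^ zero {Y} lY g =
      trans (pb^-cong K refl (trans Y-pt (sym base-pt)) (to-pt-≅-id Y-pt base-pt g)) (proj₁ (pb^-id K 0 X lX+0))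
      where Y-pt = pt-unique Y lY
    Tj-pb^ (suc n) {Y} lY g = pb^ K X g₀ , Tj-pb^ n (l-ft≡ lY) g₀ , T-pb^ n lY g₀ g
      where g₀ = to-pt (ft Y) base-pt

  sBt-section : ∀ A (lA : 0 < l A) {Y} (g : Hom Y A) → p (∂ C (sBt C A lA g)) ∘ Bt.t (sBt C A lA g) ≡ id
  sBt-section A lA g =
    ≅-to-≡ (H.trans (∘-cong≅ fe refl fe (H.sym (subst≅ (Hom V₀) fe (p V₀))) (subst≅ (λ B → Hom B V₀) (sym fe) (s A g)))
                    (H.trans (≡-to-≅ (s-sec A lA g)) (id-cong≅ (sym fe))))
    where
    V₀ = pb A (p A ∘ g)
    fe = ft-pb A lA (p A ∘ g)

  -- The S step: for g : Y → A = ft^{k+1} X and g' = ft g (retyped),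
  --   S(s_g, g'^*(X,k+2)) = g^*(X,k+1),
  -- since g^*(X,k+1) = (q(ft g,A) ∘ s_g)^*(X,k+1) = s_g^*((ft g)^*(X,k+2), k+1).
  S-pb^ : ∀ n i k X → l X ≡ suc k + suc i → ∀ {Y} → l Y ≡ n → (g : Hom Y (ft^ (suc k) X))
          (lA : 0 < l (ft^ (suc k) X)) (g' : Hom Y (ft^ (suc (suc k)) X)) → g' ≅ p (ft^ (suc k) X) ∘ g →
          SRel C (sBt C (ft^ (suc k) X) lA g) (pb^ (suc (suc k)) X g') (pb^ (suc k) X g)
  S-pb^ n i k X lX {Y} lY g lA g' g'≅ =
      l-pb A lA pg , l-le , sBt-section A lA g , pullback-eq (l W₀ ∸ l V₀) gap
    where
    A = ft^ (suc k) X
    pg = p A ∘ g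
    V₀ = pb A pg
    fe : ft V₀ ≡ Y
    fe = ft-pb A lA pg
    t₀ = subst (λ B → Hom B V₀) (sym fe) (s A g)
    W₀ = pb^ (suc (suc k)) X g'
    lX' : l X ≡ suc (suc k) + i
    lX' = trans lX (cong suc (+-suc k i))
    lV : l V₀ ≡ suc n
    lV = trans (l-suc-ft V₀ (l-pb A lA pg)) (cong suc (trans (cong l fe) lY))
    lW : l W₀ ≡ suc (suc k) + n
    lW = trans (l-pb^ (suc (suc k)) i X g' lX') (cong (suc (suc k) +_) lY)
    l-le : suc (l V₀) ≤ l W₀
    l-le = subst₂ _≤_ (sym (cong suc lV)) (sym lW) (s≤s (s≤s (m≤n+m n k)))
    gap : l W₀ ∸ l V₀ ≡ suc k
    gap = trans (cong₂ _∸_ lW lV) (m+n∸n≡m (suc k) n)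
    qa = q A pg
    W₀-shift : W₀ ≡ pb^ (suc k) X qa
    W₀-shift = proj₁ (pb^-shift (suc k) i X lX' g' pg g'≅)
    fP : ft^ (suc k) (pb^ (suc k) X qa) ≡ V₀
    fP = ft^-pb^ (suc k) (suc i) X qa lX
    pullback-eq : ∀ j → j ≡ suc k → Σ (V₀ ≡ ft^ j W₀) λ e → pb^ (suc k) X g ≡ pb^ j W₀ (subst (Hom (ft V₀)) e t₀)
    pullback-eq .(suc k) refl = e , (begin
        pb^ (suc k) X g          ≡⟨ cong (pb^ (suc k) X) (sym (s-q A lA g)) ⟩
        pb^ (suc k) X (qa ∘ s A g) ≡⟨ proj₁ (pb^-comp (suc k) (suc i) X lX qa (s A g) sg (H.sym sg≅)) ⟩
        pb^ (suc k) (pb^ (suc k) X qa) sg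
          ≡⟨ pb^-cong (suc k) (sym W₀-shift) (sym fe)
               (H.trans sg≅ (H.trans (H.sym (subst≅ (λ B → Hom B V₀) (sym fe) (s A g))) (H.sym (subst≅ (Hom (ft V₀)) e t₀)))) ⟩
        pb^ (suc k) W₀ (subst (Hom (ft V₀)) e t₀) ∎)
      where
      open ≡-Reasoning
      e : V₀ ≡ ft^ (suc k) W₀
      e = sym (trans (cong (ft^ (suc k)) W₀-shift) fP)
      sg = subst (Hom Y) (sym fP) (s A g)
      sg≅ : sg ≅ s A g
      sg≅ = subst≅ (Hom Y) (sym fP) (s A g)

  sSeq-irr : ∀ m {Y X} (e e' : l X ≡ m) (f : Hom Y X) → sSeq C m e f ≡ sSeq C m e' f
  sSeq-irr m e e' f with uip e e'
  ... | refl = refl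

  sSeq-cong : ∀ m {Y X X'} (e : l X ≡ m) (e' : l X' ≡ m) (f : Hom Y X) (f' : Hom Y X') → X ≡ X' → f ≅ f' →
              sSeq C m e f ≡ sSeq C m e' f'
  sSeq-cong m e e' f .f refl H.refl = sSeq-irr m e e' f

  sSeq-snoc : ∀ m {Y X} (e : l X ≡ suc m) (e₁ : l (ft X) ≡ m) (lX : 0 < l X) (f : Hom Y X) →
              sSeq C (suc m) e f ≡ sSeq C m e₁ (p X ∘ f) ∷ʳ sBt C X lX f
  sSeq-snoc m {X = X} e e₁ lX f =
    cong₂ _∷ʳ_ (sSeq-irr m _ e₁ _) (cong (λ lX' → sBt C X lX' f) (≤-irrelevant _ _))

  ZFold-sSeq : ∀ n i k X → l X ≡ suc k + i → ∀ {Y} → l Y ≡ n → (g : Hom Y (ft^ (suc k) X))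
               (el : l (ft^ (suc k) X) ≡ i) → ∀ Z₀ → TjRel C n Y X Z₀ →
               ZFold C Z₀ (toList (sSeq C i el g)) (pb^ (suc k) X g)
  ZFold-sSeq n zero k X lX lY g el Z₀ tj =
    lift (Tj-functional n (Weakening.Tj-pb^ X k (trans lX (cong suc (+-identityʳ k))) n lY g) tj)
  ZFold-sSeq n (suc i) k X lX {Y} lY g el Z₀ tj =
    subst (λ v → ZFold C Z₀ (toList v) (pb^ (suc k) X g)) (sym (sSeq-snoc i el el₁ lA g))
      (ZFold-snoc (sSeq C i el₁ (p A ∘ g)) (sBt C A lA g) fold-init (S-pb^ n i k X lX lY g lA g' g'≅))
    where
    A = ft^ (suc k) X
    lA = pos el
    el₁ = l-ft≡ el
    g' = subst (Hom Y) (sym (ft^-suc (suc k) X)) (p A ∘ g)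
    g'≅ = subst≅ (Hom Y) (sym (ft^-suc (suc k) X)) (p A ∘ g)
    el' = trans (cong l (ft^-suc (suc k) X)) el₁
    fold-init : ZFold C Z₀ (toList (sSeq C i el₁ (p A ∘ g))) (pb^ (suc (suc k)) X g')
    fold-init = subst (λ v → ZFold C Z₀ (toList v) (pb^ (suc (suc k)) X g'))
                      (sSeq-cong i el' el₁ g' (p A ∘ g) (ft^-suc (suc k) X) g'≅)
                      (ZFold-sSeq n i (suc k) X (trans lX (cong suc (+-suc k i))) lY g' el' Z₀ tj)

  mkBt-cong : ∀ {V₁ V₂} {t₁ : Hom (ft V₁) V₁} {t₂ : Hom (ft V₂) V₂} → V₁ ≡ V₂ → t₁ ≅ t₂ → mkBt {C = C} V₁ t₁ ≡ mkBt V₂ t₂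
  mkBt-cong refl H.refl = refl

  s-unique : ∀ X (lX : 0 < l X) {Y} (f : Hom Y X) (u : Hom Y (pb X (p X ∘ f))) →
             subst (Hom (pb X (p X ∘ f))) (ft-pb X lX (p X ∘ f)) (p (pb X (p X ∘ f))) ∘ u ≡ id →
             q X (p X ∘ f) ∘ u ≡ f → s X f ≡ u
  s-unique X lX f u sec qu =
    trans (uniq (s X f) (s-sec X lX f) (s-q X lX f)) (sym (uniq u sec qu))
    where uniq = proj₂ (proj₂ (pb-universal X lX (p X ∘ f) id f (sym (idʳ _))))

  lift-section : ∀ {Y} X (lX : 0 < l X) (g : Hom Y (ft X)) (y : Bt C) → ∂ C y ≡ pb X g →
                 p (∂ C y) ∘ Bt.t y ≡ id → Σ (Hom Y X) λ f → (p X ∘ f ≡ g) × (sBt C X lX f ≡ y)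
  lift-section {Y} X lX g (mkBt .(pb X g) t) refl sec = f , ft-f , mkBt-cong (sym pb-eq) t-eq
    where
    fe = ft-pb X lX g
    t' = subst (λ B → Hom B (pb X g)) fe t
    p' = subst (Hom (pb X g)) fe (p (pb X g))
    sec' : p' ∘ t' ≡ id
    sec' = ≅-to-≡ (H.trans (∘-cong≅ (sym fe) refl (sym fe) (subst≅ (Hom (pb X g)) fe (p (pb X g))) (subst≅ (λ B → Hom B (pb X g)) fe t))
                           (H.trans (≡-to-≅ sec) (id-cong≅ fe)))
    f = q X g ∘ t'
    ft-f : p X ∘ f ≡ g
    ft-f = begin
      p X ∘ (q X g ∘ t') ≡⟨ sym (assoc _ _ _) ⟩
      (p X ∘ q X g) ∘ t' ≡⟨ cong (_∘ t') (pb-square X lX g) ⟩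
      (g ∘ p') ∘ t'      ≡⟨ assoc _ _ _ ⟩
      g ∘ (p' ∘ t')      ≡⟨ cong (g ∘_) sec' ⟩
      g ∘ id             ≡⟨ idʳ g ⟩
      g                  ∎
      where open ≡-Reasoning
    g₁ = p X ∘ f
    pb-eq : pb X g ≡ pb X g₁
    pb-eq = pb-cong refl refl (≡-to-≅ (sym ft-f))
    fe₁ = ft-pb X lX g₁
    u = subst (Hom Y) pb-eq t'
    u-sec : subst (Hom (pb X g₁)) fe₁ (p (pb X g₁)) ∘ u ≡ id
    u-sec = ≅-to-≡ (H.trans (∘-cong≅ refl (sym pb-eq) refl
                     (H.trans (subst≅ (Hom (pb X g₁)) fe₁ (p (pb X g₁))) (H.trans (p-cong≅ (sym pb-eq)) (H.sym (subst≅ (Hom (pb X g)) fe (p (pb X g))))))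
                     (subst≅ (Hom Y) pb-eq t'))
                   (≡-to-≅ sec'))
    u-q : q X g₁ ∘ u ≡ f
    u-q = ≅-to-≡ (∘-cong≅ refl (sym pb-eq) refl (q-cong≅ refl refl (≡-to-≅ ft-f)) (subst≅ (Hom Y) pb-eq t'))
    t-eq : Bt.t (sBt C X lX f) ≅ t
    t-eq = H.trans (subst≅ (λ A → Hom A (pb X g₁)) (sym fe₁) (s X f))
             (H.trans (≡-to-≅ (s-unique X lX f u u-sec u-q))
               (H.trans (subst≅ (Hom Y) pb-eq t') (subst≅ (λ B → Hom B (pb X g)) fe t)))

  module _ (n m : ℕ) {Y X : Ob} (lY : l Y ≡ n) (lX : l X ≡ suc m) where
    InductiveCondition : Vec (Bt C) (suc m) → Set (o ⊔ h)
    InductiveCondition ss =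
      Corresponds C m Y (ft X) (init ss) × Σ Ob (λ Z₀ → TjRel C n Y X Z₀ × ZFold C Z₀ (toList (init ss)) (∂ C (last ss)))

    -- Z_{m+1,0} = T_n(Y,X) = (Y → pt)^*(X,m+1).
    Z₀ : Ob
    Z₀ = pb^ (suc m) X (to-pt Y (Weakening.base-pt X m lX))

    Z₀-weakening : TjRel C n Y X Z₀
    Z₀-weakening = Weakening.Tj-pb^ X m lX n lY _

    fold-to-pb : (g : Hom Y (ft X)) (e : l (ft X) ≡ m) → ZFold C Z₀ (toList (sSeq C m e g)) (pb X g)
    fold-to-pb g e = ZFold-sSeq n m 0 X lX lY g e Z₀ Z₀-weakening

    forward : ∀ ss → Corresponds C (suc m) Y X ss → InductiveCondition ss
    forward .(sSeq C (suc m) e f) (e , f , refl)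
      rewrite sSeq-snoc m e (l-ft≡ lX) (pos lX) f
            | init-∷ʳ (sBt C X (pos lX) f) (sSeq C m (l-ft≡ lX) (p X ∘ f))
            | last-∷ʳ (sBt C X (pos lX) f) (sSeq C m (l-ft≡ lX) (p X ∘ f))
      = (l-ft≡ lX , p X ∘ f , refl) , Z₀ , Z₀-weakening , fold-to-pb (p X ∘ f) (l-ft≡ lX)

    backward : ∀ ss → (∀ (i : Fin (suc m)) → InBt C n (lookup ss i)) → InductiveCondition ss → Corresponds C (suc m) Y X ss
    backward ss inB ((e , g , seq-g) , (Z , Z-weakening , fold)) = lX , f , (begin
        sSeq C (suc m) lX f                         ≡⟨ sSeq-snoc m lX e (pos lX) f ⟩
        sSeq C m e (p X ∘ f) ∷ʳ sBt C X (pos lX) f   ≡⟨ cong₂ _∷ʳ_ (trans (sSeq-cong m e e (p X ∘ f) g refl (≡-to-≅ ft-f)) seq-g) s-f ⟩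
        init ss ∷ʳ last ss                          ≡⟨ sym (proj₂ (proj₂ (initLast ss))) ⟩
        ss                                          ∎)
      where
      open ≡-Reasoning
      -- ∂(s_{m+1}) = Z_{m+1,m} = g^*X, by uniqueness of T_n and of the fold.
      ∂-last : ∂ C (last ss) ≡ pb X g
      ∂-last = ZFold-functional (toList (init ss)) fold
                 (subst (λ W → ZFold C W (toList (init ss)) (pb X g)) (Tj-functional n Z₀-weakening Z-weakening)
                   (subst (λ v → ZFold C Z₀ (toList v) (pb X g)) seq-g (fold-to-pb g e)))
      last-section : p (∂ C (last ss)) ∘ Bt.t (last ss) ≡ id
      last-section = proj₂ (subst (InBt C n) (lookup-last ss) (inB (fromℕ m)))
      lifted = lift-section X (pos lX) g (last ss) ∂-last last-section
      f = proj₁ lifted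
      ft-f = proj₁ (proj₂ lifted)
      s-f = proj₂ (proj₂ lifted)

lemma2p9 : ∀ {o h : Level} (C : CSystem o h) → let open CSystem C in
    (n m : ℕ) (Y X : Ob) → l Y ≡ n → l X ≡ suc m →
    (ss : Vec (Bt C) (suc m)) → (∀ (i : Fin (suc m)) → InBt C n (lookup ss i)) →
    (Corresponds C (suc m) Y X ss
      ⇔ (Corresponds C m Y (ft X) (init ss)
          × Σ Ob (λ Z₀ → TjRel C n Y X Z₀ × ZFold C Z₀ (toList (init ss)) (∂ C (last ss)))))
lemma2p9 C n m Y X lY lX ss inB =
  mk⇔ (Development.forward C n m lY lX ss) (Development.backward C n m lY lX ss inB)
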